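{- For all integers $i,j\ge 0$, the partial descent set statistic $\mathrm{Des}_{i,j}$ is shuffle-compatible.
   Context: A permutation of length $n$ is a sequence $\pi=\pi_1\cdots\pi_n$ of $n$ distinct positive integers. A permutation statistic is a function $\mathrm{st}$ on permutations such that $\mathrm{st}(\pi)=\mathrm{st}(\sigma)$ whenever $\pi$ and $\sigma$ have the same relative order (i.e., the same standardization). Two permutations are disjoint if they share no letters; for disjoint $\pi,\sigma$, $S(\pi,\sigma)$ is the set of permutations of length $|\pi|+|\sigma|$ containing both $\pi$ and $\sigma$ as subsequences (shuffles). A statistic $\mathrm{st}$ is shuffle-compatible if for any disjoint $\pi,\sigma$ the multiset $\{\mathrm{st}(\tau):\tau\in S(\pi,\sigma)\}$ depends only on $\mathrm{st}(\pi)$, $\mathrm{st}(\sigma)$, $|\pi|$ and $|\sigma|$. The descent set of $\pi$ of length $n$ is $\mathrm{Des}(\pi)=\{k\in[n-1]:\pi_k>\pi_{k+1}\}$, and the partial descent set is $\mathrm{Des}_{i,j}(\pi)=\mathrm{Des}(\pi)\cap(\{1,2,\dots,i\}\cup\{n-1,n-2,\dots,n-j\})$. -}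

module Defs where

open import Data.Nat using (ℕ; zero; suc; _+_; _∸_; _≤_; _<_; _≤?_; _<?_)
open import Data.Nat.Properties using (_≟_)
open import Data.List using (List; []; _∷_; length; filter)
open import Data.List.Relation.Unary.All using (All; all?)
open import Data.List.Relation.Unary.Unique.Propositional using (Unique)
open import Data.List.Relation.Unary.Unique.DecPropositional _≟_ using (unique?)
open import Data.List.Relation.Binary.Sublist.Propositional using (_⊆_)
open import Data.List.Relation.Binary.Sublist.DecPropositional _≟_ using (_⊆?_)
open import Data.List.Relation.Binary.Disjoint.Propositional using (Disjoint)
open import Data.Product using (Σ; _×_; proj₁)
open import Data.Sum using (_⊎_)
open import Relation.Nullary using (Dec; yes; no; does)
open import Relation.Nullary.Decidable using (True; _×-dec_; _⊎-dec_)
open import Relation.Binary.PropositionalEquality using (_≡_)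
open import Data.Bool using (if_then_else_)
open import Function.Bundles using (_↔_; Inverse)

IsPerm : List ℕ → Set
IsPerm π = Unique π × All (λ x → 0 < x) π

isPerm? : (π : List ℕ) → Dec (IsPerm π)
isPerm? π = unique? π ×-dec all? (λ x → 0 <? x) π

InShuffleSet : List ℕ → List ℕ → List ℕ → Set
InShuffleSet π σ τ =
  IsPerm τ × (length τ ≡ length π + length σ) × (π ⊆ τ) × (σ ⊆ τ)

inShuffleSet? : (π σ τ : List ℕ) → Dec (InShuffleSet π σ τ)
inShuffleSet? π σ τ =
  isPerm? τ ×-dec (length τ ≟ length π + length σ) ×-dec (π ⊆? τ) ×-dec (σ ⊆? τ)

ShuffleSet : List ℕ → List ℕ → Set
ShuffleSet π σ = Σ (List ℕ) (λ τ → True (inShuffleSet? π σ τ))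

-- Multiset equality is expressed as
-- the existence of an st-preserving bijection between the shuffle sets.
ShuffleCompatible : {B : Set} → (List ℕ → B) → Set
ShuffleCompatible st =
  ∀ (π σ π′ σ′ : List ℕ) →
  IsPerm π → IsPerm σ → Disjoint π σ →
  IsPerm π′ → IsPerm σ′ → Disjoint π′ σ′ →
  st π ≡ st π′ → st σ ≡ st σ′ →
  length π ≡ length π′ → length σ ≡ length σ′ →
  Σ (ShuffleSet π σ ↔ ShuffleSet π′ σ′)
    (λ f → ∀ (x : ShuffleSet π σ) → st (proj₁ (Inverse.to f x)) ≡ st (proj₁ x))

-- Descent set (1-based positions, increasing order):
-- Des(π) = { k ∈ [n-1] : π_k > π_{k+1} }.
-- desAfter k x ys: descent positions of the word x ∷ ys, where x sits at
-- position k.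
desAfter : ℕ → ℕ → List ℕ → List ℕ
desAfter k x []       = []
desAfter k x (y ∷ ys) =
  if does (y <? x) then k ∷ desAfter (suc k) y ys else desAfter (suc k) y ys

Des : List ℕ → List ℕ
Des []       = []
Des (x ∷ xs) = desAfter 1 x xs

DesPartial : ℕ → ℕ → List ℕ → List ℕ
DesPartial i j π = filter (λ k → (k ≤? i) ⊎-dec ((length π ∸ j) ≤? k)) (Des π)

-- A shuffle of π and σ is encoded by its shuffle word, recording from which
-- factor each letter is taken; for disjoint permutations this identifies
-- S(π,σ) with the shuffle words of type (|π|,|σ|) (shuffleSet↔).  A shuffle
-- equivalence for a statistic st between two pairs of words is a bijection
-- of shuffle words preserving st of the corresponding shuffles; between
-- pairs of disjoint permutations it yields exactly the st-preserving
-- bijection of shuffle sets asked for (shuffleSet-bijection).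
--
-- 1. Separation (Des is preserved).  If a letter of π exceeds a letter of
--    σ, pick such a pair a > b with no letter of π or σ strictly between
--    them and interchange the values a and b.  The descent sets of the two
--    words are unchanged, and exchanging a and b in a shuffle exactly when
--    they stand next to each other is a Des-preserving shuffle equivalence.
--    The sum of the left word drops, so iterating this reaches a pair in
--    which every letter of the left word lies below the right word.
-- 2. For pairs lying below/above, a descent between letters of different
--    factors is read off the shuffle word, and a descent inside a factor in
--    the window {1..i} ∪ {n-j..n-1} of the shuffle lies in the window of the
--    factor.  So factors with equal Des_{i,j} give corresponding shuffles
--    with equal Des_{i,j}.
-- 3. Des_{i,j} is a function of Des and the length, so the equivalences of
--    step 1 for both pairs, composed with step 2, prove the theorem.
module Submission where

open import Defs
open import Data.Nat using (ℕ; zero; suc; _+_; _∸_; _≤_; _<_; _≤?_; _<?_; z≤n; s≤s)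
open import Data.Nat.Properties
  using ( _≟_; +-suc; +-comm; suc-injective; ≤-refl; ≤-trans; n≤1+n; <⇒≤; <-irrefl; <-asym; <-trans
        ; <-cmp; ≮⇒≥; ≤∧≢⇒<; +-monoʳ-≤; +-mono-≤; +-mono-<-≤; +-mono-≤-<; m≤n+o⇒m∸n≤o; m+1+n≰m
        ; ∸-monoˡ-<; ∸-monoʳ-< )
open import Data.Nat.Induction using (<-wellFounded)
open import Data.Nat.ListAction using (sum)
open import Induction.WellFounded using (Acc; acc)
open import Data.Bool using (Bool; true; false; _∧_; if_then_else_)
open import Data.Bool.Properties using (T-irrelevant; ∧-zeroʳ; ∧-identityʳ)
open import Data.Empty using (⊥; ⊥-elim)
open import Data.Unit using (⊤; tt)
open import Data.Product as Product using (Σ; ∃₂; _×_; _,_; proj₁; proj₂; curry)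
open import Data.Sum as Sum using (_⊎_; inj₁; inj₂)
open import Data.List as List using (List; []; _∷_; length; filter)
open import Data.List.Properties using (∷-injective; ∷-injectiveˡ; ∷-injectiveʳ)
open import Data.List.Membership.Propositional using (_∈_; _∉_; find)
open import Data.List.Membership.Propositional.Properties using (∈-map⁻)
open import Data.List.Relation.Unary.All as All using (All; []; _∷_; all?)
open import Data.List.Relation.Unary.All.Properties using (¬Any⇒All¬; All¬⇒¬Any; ¬All⇒Any¬; filter⁺)
open import Data.List.Relation.Unary.Any as Any using (Any; here; there; any?)
open import Data.List.Relation.Unary.AllPairs using ([]; _∷_)
open import Data.List.Relation.Unary.Unique.Propositional using (Unique)
open import Data.List.Relation.Unary.Unique.Propositional.Properties using () renaming (map⁺ to Unique-map⁺)
open import Data.List.Relation.Binary.Sublist.Propositional using (_⊆_; []; _∷_; _∷ʳ_)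
open import Data.List.Relation.Binary.Sublist.Propositional.Properties using (length-mono-≤)
open import Data.List.Relation.Binary.Disjoint.Propositional using (Disjoint; contractₗ; contractᵣ)
open import Data.Vec as Vec using (Vec; []; _∷_; toList; fromList)
open import Data.Vec.Properties using (toList-map; toList∘fromList; length-toList)
open import Relation.Nullary using (¬_; Dec; yes; no; does; contradiction)
open import Relation.Nullary.Decidable
  using (toWitness; fromWitness; _×-dec_; _⊎-dec_; dec-true; dec-false; does-⇔)
open import Relation.Binary.Definitions using (tri<; tri≈; tri>)
open import Relation.Binary.PropositionalEquality
open import Function.Base using (_∘_)
open import Function.Bundles using (_↔_; Inverse; mk↔ₛ′; mk⇔)
open import Function.Properties.Inverse using (↔-refl; ↔-sym; ↔-trans)

unique-head : ∀ {x : ℕ} {τ} → Unique (x ∷ τ) → x ∉ τ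
unique-head (x∉τ ∷ _) = All¬⇒¬Any x∉τ

unique-tail : ∀ {x : ℕ} {τ} → Unique (x ∷ τ) → Unique τ
unique-tail (_ ∷ u) = u

data Shuffle : ℕ → ℕ → Set where
  done  : Shuffle 0 0
  left  : ∀ {m n} → Shuffle m n → Shuffle (suc m) n
  right : ∀ {m n} → Shuffle m n → Shuffle m (suc n)

merge : ∀ {m n} → Shuffle m n → Vec ℕ m → Vec ℕ n → List ℕ
merge done      []       []       = []
merge (left w)  (x ∷ xs) ys       = x ∷ merge w xs ys
merge (right w) xs       (y ∷ ys) = y ∷ merge w xs ys

merge-∈ : ∀ {m n z} (w : Shuffle m n) xs ys → z ∈ merge w xs ys → z ∈ toList xs ⊎ z ∈ toList ys
merge-∈ done      []       []       ()
merge-∈ (left w)  (x ∷ xs) ys (here e) = inj₁ (here e)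
merge-∈ (left w)  (x ∷ xs) ys (there p) with merge-∈ w xs ys p
... | inj₁ q = inj₁ (there q)
... | inj₂ q = inj₂ q
merge-∈ (right w) xs (y ∷ ys) (here e) = inj₂ (here e)
merge-∈ (right w) xs (y ∷ ys) (there p) with merge-∈ w xs ys p
... | inj₁ q = inj₁ q
... | inj₂ q = inj₂ (there q)

merge-∉ : ∀ {m n z} (w : Shuffle m n) xs ys → z ∉ toList xs → z ∉ toList ys → z ∉ merge w xs ys
merge-∉ w xs ys z∉xs z∉ys p with merge-∈ w xs ys p
... | inj₁ q = z∉xs q
... | inj₂ q = z∉ys q

merge-length : ∀ {m n} (w : Shuffle m n) xs ys → length (merge w xs ys) ≡ m + n
merge-length done      []       []       = refl
merge-length (left w)  (x ∷ xs) ys       = cong suc (merge-length w xs ys)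
merge-length (right w) xs       (y ∷ ys) =
  trans (cong suc (merge-length w xs ys)) (sym (+-suc _ _))

merge-⊆ˡ : ∀ {m n} (w : Shuffle m n) xs ys → toList xs ⊆ merge w xs ys
merge-⊆ˡ done      []       []       = []
merge-⊆ˡ (left w)  (x ∷ xs) ys       = refl ∷ merge-⊆ˡ w xs ys
merge-⊆ˡ (right w) xs       (y ∷ ys) = y ∷ʳ merge-⊆ˡ w xs ys

merge-⊆ʳ : ∀ {m n} (w : Shuffle m n) xs ys → toList ys ⊆ merge w xs ys
merge-⊆ʳ done      []       []       = []
merge-⊆ʳ (left w)  (x ∷ xs) ys       = x ∷ʳ merge-⊆ʳ w xs ys
merge-⊆ʳ (right w) xs       (y ∷ ys) = refl ∷ merge-⊆ʳ w xs ys

merge-All : ∀ {P : ℕ → Set} {m n} (w : Shuffle m n) xs ys →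
            All P (toList xs) → All P (toList ys) → All P (merge w xs ys)
merge-All done      []       []       _          _          = []
merge-All (left w)  (x ∷ xs) ys       (px ∷ pxs) pys        = px ∷ merge-All w xs ys pxs pys
merge-All (right w) xs       (y ∷ ys) pxs        (py ∷ pys) = py ∷ merge-All w xs ys pxs pys

merge-Unique : ∀ {m n} (w : Shuffle m n) xs ys → Unique (toList xs) → Unique (toList ys) →
               Disjoint (toList xs) (toList ys) → Unique (merge w xs ys)
merge-Unique done [] [] _ _ _ = []
merge-Unique (left w) (x ∷ xs) ys uxs uys xs#ys =
  ¬Any⇒All¬ _ (merge-∉ w xs ys (unique-head uxs) (λ x∈ys → xs#ys (here refl , x∈ys)))
    ∷ merge-Unique w xs ys (unique-tail uxs) uys (contractₗ xs#ys)
merge-Unique (right w) xs (y ∷ ys) uxs uys xs#ys =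
  ¬Any⇒All¬ _ (merge-∉ w xs ys (λ y∈xs → xs#ys (y∈xs , here refl)) (unique-head uys))
    ∷ merge-Unique w xs ys uxs (unique-tail uys) (contractᵣ xs#ys)

merge-injective : ∀ {m n} (w w′ : Shuffle m n) xs ys → Disjoint (toList xs) (toList ys) →
                  merge w xs ys ≡ merge w′ xs ys → w ≡ w′
merge-injective done done [] [] _ _ = refl
merge-injective (left w) (left w′) (x ∷ xs) ys xs#ys e =
  cong left (merge-injective w w′ xs ys (contractₗ xs#ys) (∷-injectiveʳ e))
merge-injective (right w) (right w′) xs (y ∷ ys) xs#ys e =
  cong right (merge-injective w w′ xs ys (contractᵣ xs#ys) (∷-injectiveʳ e))
merge-injective (left w) (right w′) (x ∷ xs) (y ∷ ys) xs#ys e =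
  ⊥-elim (xs#ys (here refl , here (∷-injectiveˡ e)))
merge-injective (right w) (left w′) (x ∷ xs) (y ∷ ys) xs#ys e =
  ⊥-elim (xs#ys (here (∷-injectiveˡ e) , here refl))

disjoint-sublists-length : ∀ {π σ τ : List ℕ} → Disjoint π σ → π ⊆ τ → σ ⊆ τ →
                           length π + length σ ≤ length τ
disjoint-sublists-length _ [] [] = z≤n
disjoint-sublists-length π#σ (t ∷ʳ p) (.t ∷ʳ q) =
  ≤-trans (disjoint-sublists-length π#σ p q) (n≤1+n _)
disjoint-sublists-length π#σ (refl ∷ p) (t ∷ʳ q) = s≤s (disjoint-sublists-length (contractₗ π#σ) p q)
disjoint-sublists-length {π} {_ ∷ σ} {_ ∷ τ} π#σ (t ∷ʳ p) (refl ∷ q) =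
  subst (_≤ suc (length τ)) (sym (+-suc (length π) (length σ)))
        (s≤s (disjoint-sublists-length (contractᵣ π#σ) p q))
disjoint-sublists-length π#σ (refl ∷ p) (refl ∷ q) = ⊥-elim (π#σ (here refl , here refl))

merge-surjective : ∀ (π σ τ : List ℕ) → Disjoint π σ → π ⊆ τ → σ ⊆ τ →
                   length τ ≡ length π + length σ →
                   Σ (Shuffle (length π) (length σ)) (λ w → merge w (fromList π) (fromList σ) ≡ τ)
merge-surjective [] [] [] _ [] [] _ = done , refl
merge-surjective π σ (t ∷ τ) π#σ (.t ∷ʳ p) (.t ∷ʳ q) e =
  ⊥-elim (<-irrefl (sym e) (s≤s (disjoint-sublists-length π#σ p q)))
merge-surjective (x ∷ π) σ (x ∷ τ) π#σ (refl ∷ p) (x ∷ʳ q) e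
  with merge-surjective π σ τ (contractₗ π#σ) p q (suc-injective e)
... | w , refl = left w , refl
merge-surjective π (y ∷ σ) (y ∷ τ) π#σ (y ∷ʳ p) (refl ∷ q) e
  with merge-surjective π σ τ (contractᵣ π#σ) p q (suc-injective (trans e (+-suc _ _)))
... | w , refl = right w , refl
merge-surjective (x ∷ π) (.x ∷ σ) (x ∷ τ) π#σ (refl ∷ p) (refl ∷ q) e =
  ⊥-elim (π#σ (here refl , here refl))

via-fromList : ∀ {P : List ℕ → Set} π → P π → P (toList (fromList π))
via-fromList {P} π = subst P (sym (toList∘fromList π))

via-fromList₂ : ∀ {R : List ℕ → List ℕ → Set} π σ → R π σ → R (toList (fromList π)) (toList (fromList σ))
via-fromList₂ {R} π σ = subst₂ R (sym (toList∘fromList π)) (sym (toList∘fromList σ))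

via-map : ∀ {P : List ℕ → Set} (f : ℕ → ℕ) {k} (zs : Vec ℕ k) →
          P (List.map f (toList zs)) → P (toList (Vec.map f zs))
via-map {P} f zs = subst P (sym (toList-map f zs))

shuffleSet↔ : ∀ π σ → IsPerm π → IsPerm σ → Disjoint π σ →
  Σ (ShuffleSet π σ ↔ Shuffle (length π) (length σ))
    (λ f → ∀ w → proj₁ (Inverse.from f w) ≡ merge w (fromList π) (fromList σ))
shuffleSet↔ π σ (uπ , pπ) (uσ , pσ) π#σ = mk↔ₛ′ to from to∘from from∘to , λ _ → refl
  where
  xs : Vec ℕ (length π)
  xs = fromList π
  ys : Vec ℕ (length σ)
  ys = fromList σ
  xs#ys : Disjoint (toList xs) (toList ys)
  xs#ys = via-fromList₂ {Disjoint} π σ π#σ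

  from : Shuffle (length π) (length σ) → ShuffleSet π σ
  from w = merge w xs ys , fromWitness
    ( ( merge-Unique w xs ys (via-fromList {Unique} π uπ) (via-fromList {Unique} σ uσ) xs#ys
      , merge-All w xs ys (via-fromList {All (0 <_)} π pπ) (via-fromList {All (0 <_)} σ pσ))
    , merge-length w xs ys
    , subst (_⊆ merge w xs ys) (toList∘fromList π) (merge-⊆ˡ w xs ys)
    , subst (_⊆ merge w xs ys) (toList∘fromList σ) (merge-⊆ʳ w xs ys))

  decompose : (τ : ShuffleSet π σ) → Σ (Shuffle (length π) (length σ)) (λ w → merge w xs ys ≡ proj₁ τ)
  decompose (τ , τ∈S) with toWitness τ∈S
  ... | _ , len , π⊆τ , σ⊆τ = merge-surjective π σ τ π#σ π⊆τ σ⊆τ len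

  to : ShuffleSet π σ → Shuffle (length π) (length σ)
  to τ = proj₁ (decompose τ)

  from∘to : ∀ τ → from (to τ) ≡ τ
  from∘to (τ , τ∈S) with decompose (τ , τ∈S)
  ... | w , refl = cong (τ ,_) (T-irrelevant _ τ∈S)

  to∘from : ∀ w → to (from w) ≡ w
  to∘from w = merge-injective _ w xs ys xs#ys (proj₂ (decompose (from w)))

record ShuffleEquiv {B : Set} (st : List ℕ → B) {m n m′ n′}
                    (xs : Vec ℕ m) (ys : Vec ℕ n) (xs′ : Vec ℕ m′) (ys′ : Vec ℕ n′) : Set where
  constructor equivalence
  field
    bijection : Shuffle m n ↔ Shuffle m′ n′
    preserves : ∀ w → st (merge (Inverse.to bijection w) xs′ ys′) ≡ st (merge w xs ys)

module _ {B : Set} {st : List ℕ → B} where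

  equiv-refl : ∀ {m n} (xs : Vec ℕ m) (ys : Vec ℕ n) → ShuffleEquiv st xs ys xs ys
  equiv-refl xs ys = equivalence ↔-refl (λ _ → refl)

  equiv-sym : ∀ {m n m′ n′} {xs : Vec ℕ m} {ys : Vec ℕ n} {xs′ : Vec ℕ m′} {ys′ : Vec ℕ n′} →
              ShuffleEquiv st xs ys xs′ ys′ → ShuffleEquiv st xs′ ys′ xs ys
  equiv-sym {xs = xs} {ys} {xs′} {ys′} (equivalence f st-f) = equivalence (↔-sym f) λ w → begin
    st (merge (from w) xs ys)                ≡⟨ st-f (from w) ⟨
    st (merge (to (from w)) xs′ ys′)         ≡⟨ cong (λ v → st (merge v xs′ ys′)) (strictlyInverseˡ w) ⟩
    st (merge w xs′ ys′)                     ∎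
    where open Inverse f
          open ≡-Reasoning

  equiv-trans : ∀ {m n m′ n′ m″ n″} {xs : Vec ℕ m} {ys : Vec ℕ n} {xs′ : Vec ℕ m′} {ys′ : Vec ℕ n′}
                  {xs″ : Vec ℕ m″} {ys″ : Vec ℕ n″} →
                ShuffleEquiv st xs ys xs′ ys′ → ShuffleEquiv st xs′ ys′ xs″ ys″ →
                ShuffleEquiv st xs ys xs″ ys″
  equiv-trans (equivalence f st-f) (equivalence g st-g) =
    equivalence (↔-trans f g) λ w → trans (st-g (Inverse.to f w)) (st-f w)

equiv-coarsen : ∀ {B C : Set} {st : List ℕ → B} (st′ : List ℕ → C) →
                (∀ τ τ′ → length τ ≡ length τ′ → st τ ≡ st τ′ → st′ τ ≡ st′ τ′) →
                ∀ {m n} {xs xs′ : Vec ℕ m} {ys ys′ : Vec ℕ n} →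
                ShuffleEquiv st xs ys xs′ ys′ → ShuffleEquiv st′ xs ys xs′ ys′
equiv-coarsen st′ determined {xs = xs} {xs′} {ys} {ys′} (equivalence f st-f) = equivalence f λ w →
  determined _ _ (trans (merge-length (Inverse.to f w) xs′ ys′) (sym (merge-length w xs ys))) (st-f w)

shuffleSet-bijection : ∀ {B : Set} (st : List ℕ → B) π σ π′ σ′ →
  IsPerm π → IsPerm σ → Disjoint π σ → IsPerm π′ → IsPerm σ′ → Disjoint π′ σ′ →
  ShuffleEquiv st (fromList π) (fromList σ) (fromList π′) (fromList σ′) →
  Σ (ShuffleSet π σ ↔ ShuffleSet π′ σ′) (λ f → ∀ x → st (proj₁ (Inverse.to f x)) ≡ st (proj₁ x))
shuffleSet-bijection st π σ π′ σ′ pπ pσ π#σ pπ′ pσ′ π′#σ′ (equivalence f st-f) =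
  ↔-trans E (↔-trans f (↔-sym E′)) , preserves
  where
  E : ShuffleSet π σ ↔ Shuffle (length π) (length σ)
  E = proj₁ (shuffleSet↔ π σ pπ pσ π#σ)
  E′ : ShuffleSet π′ σ′ ↔ Shuffle (length π′) (length σ′)
  E′ = proj₁ (shuffleSet↔ π′ σ′ pπ′ pσ′ π′#σ′)
  preserves : ∀ x → st (proj₁ (Inverse.from E′ (Inverse.to f (Inverse.to E x)))) ≡ st (proj₁ x)
  preserves x = begin
    st (proj₁ (Inverse.from E′ (Inverse.to f w)))
      ≡⟨ cong st (proj₂ (shuffleSet↔ π′ σ′ pπ′ pσ′ π′#σ′) _) ⟩
    st (merge (Inverse.to f w) (fromList π′) (fromList σ′)) ≡⟨ st-f w ⟩
    st (merge w (fromList π) (fromList σ))              ≡⟨ cong st (proj₂ (shuffleSet↔ π σ pπ pσ π#σ) w) ⟨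
    st (proj₁ (Inverse.from E w))                       ≡⟨ cong (st ∘ proj₁) (Inverse.strictlyInverseʳ E x) ⟩
    st (proj₁ x)                                        ∎
    where w : Shuffle (length π) (length σ)
          w = Inverse.to E x
          open ≡-Reasoning

module Transposition (a b : ℕ) where

  transpose : ℕ → ℕ
  transpose x with x ≟ a | x ≟ b
  ... | yes _ | _     = b
  ... | no _  | yes _ = a
  ... | no _  | no _  = x

  transpose-a : transpose a ≡ b
  transpose-a with a ≟ a
  ... | yes _ = refl
  ... | no a≢a = contradiction refl a≢a

  transpose-b : a ≢ b → transpose b ≡ a
  transpose-b a≢b with b ≟ a | b ≟ b
  ... | yes b≡a | _     = contradiction (sym b≡a) a≢b
  ... | no _    | yes _ = refl
  ... | no _    | no b≢b = contradiction refl b≢b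

  transpose-other : ∀ {x} → x ≢ a → x ≢ b → transpose x ≡ x
  transpose-other {x} x≢a x≢b with x ≟ a | x ≟ b
  ... | yes x≡a | _     = contradiction x≡a x≢a
  ... | no _    | yes x≡b = contradiction x≡b x≢b
  ... | no _    | no _  = refl

  data Kind (x : ℕ) : Set where
    is-a  : x ≡ a → Kind x
    is-b  : x ≡ b → Kind x
    other : x ≢ a → x ≢ b → Kind x

  kind : ∀ x → Kind x
  kind x with x ≟ a | x ≟ b
  ... | yes x≡a | _       = is-a x≡a
  ... | no _    | yes x≡b = is-b x≡b
  ... | no x≢a  | no x≢b  = other x≢a x≢b

  IsPair : ℕ → ℕ → Set
  IsPair u v = (u ≡ a × v ≡ b) ⊎ (u ≡ b × v ≡ a)

  pair-sym : ∀ {u v} → IsPair u v → IsPair v u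
  pair-sym (inj₁ (u≡a , v≡b)) = inj₂ (v≡b , u≡a)
  pair-sym (inj₂ (u≡b , v≡a)) = inj₁ (v≡a , u≡b)

  no-pair : ∀ {u v} → (u ≡ a → v ≢ b) → (u ≡ b → v ≢ a) → ¬ IsPair u v
  no-pair not-ab not-ba (inj₁ (u≡a , v≡b)) = not-ab u≡a v≡b
  no-pair not-ab not-ba (inj₂ (u≡b , v≡a)) = not-ba u≡b v≡a

  data Adjacent : List ℕ → Set where
    now   : ∀ {u v τ} → IsPair u v → Adjacent (u ∷ v ∷ τ)
    later : ∀ {u τ} → Adjacent τ → Adjacent (u ∷ τ)

  adjacent-∈ : ∀ {τ} → Adjacent τ → a ∈ τ × b ∈ τ
  adjacent-∈ (now (inj₁ (refl , refl))) = here refl , there (here refl)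
  adjacent-∈ (now (inj₂ (refl , refl))) = there (here refl) , here refl
  adjacent-∈ (later adj) = Product.map there there (adjacent-∈ adj)

  NoPairAt : ℕ → List ℕ → Set
  NoPairAt x []      = ⊤
  NoPairAt x (v ∷ _) = ¬ IsPair x v

  ¬adjacent-∷ : ∀ {x τ} → NoPairAt x τ → ¬ Adjacent τ → ¬ Adjacent (x ∷ τ)
  ¬adjacent-∷ {τ = _ ∷ _} no-pair-x _       (now p)     = no-pair-x p
  ¬adjacent-∷              _         ¬adj-τ (later adj) = ¬adj-τ adj

  -- The exchange on shuffle words: where the shuffle takes a from the left
  -- word immediately followed by b from the right word (or b then a),
  -- take the two letters in the opposite order; change nothing else.
  exchange : ∀ {m n} → Shuffle m n → Vec ℕ m → Vec ℕ n → Shuffle m n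
  exchange done [] [] = done
  exchange (left (right w)) (x ∷ xs) (y ∷ ys) with (x ≟ a) ×-dec (y ≟ b)
  ... | yes _ = right (left w)
  ... | no _  = left (exchange (right w) xs (y ∷ ys))
  exchange (right (left w)) (x ∷ xs) (y ∷ ys) with (x ≟ a) ×-dec (y ≟ b)
  ... | yes _ = left (right w)
  ... | no _  = right (exchange (left w) (x ∷ xs) ys)
  exchange (left w)  (x ∷ xs) ys       = left (exchange w xs ys)
  exchange (right w) xs       (y ∷ ys) = right (exchange w xs ys)

  map-fixed : ∀ {m} (xs : Vec ℕ m) → a ∉ toList xs → b ∉ toList xs → Vec.map transpose xs ≡ xs
  map-fixed []       _    _    = refl
  map-fixed (x ∷ xs) a∉xs b∉xs =
    cong₂ _∷_ (transpose-other (λ x≡a → a∉xs (here (sym x≡a))) (λ x≡b → b∉xs (here (sym x≡b))))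
              (map-fixed xs (a∉xs ∘ there) (b∉xs ∘ there))

  -- The effect of the exchange on shuffles: if a and b are adjacent in the
  -- shuffle τ, the exchanged shuffle of the transposed words is τ itself,
  -- otherwise it is τ with a and b interchanged.
  Outcome : List ℕ → List ℕ → Set
  Outcome τ τ′ = (Adjacent τ × τ′ ≡ τ) ⊎ (¬ Adjacent τ × τ′ ≡ List.map transpose τ)

  outcome-∷ : ∀ {x τ τ′} → x ∉ τ → NoPairAt x τ → Outcome τ τ′ → Outcome (x ∷ τ) (transpose x ∷ τ′)
  outcome-∷ x∉τ _ (inj₁ (adj , refl)) =
    inj₁ (later adj , cong (_∷ _) (transpose-other (λ { refl → x∉τ (proj₁ (adjacent-∈ adj)) })
                                                  (λ { refl → x∉τ (proj₂ (adjacent-∈ adj)) })))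
  outcome-∷ _ no-pair-x (inj₂ (¬adj , refl)) = inj₂ (¬adjacent-∷ no-pair-x ¬adj , refl)

  record Placed {m n} (xs : Vec ℕ m) (ys : Vec ℕ n) : Set where
    field
      uniqueˡ  : Unique (toList xs)
      uniqueʳ  : Unique (toList ys)
      disjoint : Disjoint (toList xs) (toList ys)
      b∉ˡ      : b ∉ toList xs
      a∉ʳ      : a ∉ toList ys

  module _ {m n} {xs : Vec ℕ m} {ys : Vec ℕ n} where
    open Placed

    placed-tailˡ : ∀ {x} → Placed (x ∷ xs) ys → Placed xs ys
    placed-tailˡ P = record
      { uniqueˡ = unique-tail (uniqueˡ P) ; uniqueʳ = uniqueʳ P ; disjoint = contractₗ (disjoint P)
      ; b∉ˡ = b∉ˡ P ∘ there ; a∉ʳ = a∉ʳ P }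

    placed-tailʳ : ∀ {y} → Placed xs (y ∷ ys) → Placed xs ys
    placed-tailʳ P = record
      { uniqueˡ = uniqueˡ P ; uniqueʳ = unique-tail (uniqueʳ P) ; disjoint = contractᵣ (disjoint P)
      ; b∉ˡ = b∉ˡ P ; a∉ʳ = a∉ʳ P ∘ there }

    fresh-left : ∀ {x} (w : Shuffle m n) → Placed (x ∷ xs) ys → x ∉ merge w xs ys
    fresh-left w P = merge-∉ w xs ys (unique-head (uniqueˡ P)) (λ x∈ys → disjoint P (here refl , x∈ys))

    fresh-right : ∀ {y} (w : Shuffle m n) → Placed xs (y ∷ ys) → y ∉ merge w xs ys
    fresh-right w P = merge-∉ w xs ys (λ y∈xs → disjoint P (y∈xs , here refl)) (unique-head (uniqueʳ P))

    heads-differ : Placed (a ∷ xs) (b ∷ ys) → a ≢ b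
    heads-differ P a≡b = disjoint P (here refl , here a≡b)

    rest-fixed : (w : Shuffle m n) → Placed (a ∷ xs) (b ∷ ys) →
                 merge w (Vec.map transpose xs) (Vec.map transpose ys) ≡ merge w xs ys
    rest-fixed w P = cong₂ (merge w) (map-fixed xs (unique-head (uniqueˡ P)) (b∉ˡ P ∘ there))
                                     (map-fixed ys (a∉ʳ P ∘ there) (unique-head (uniqueʳ P)))

  open Placed

  outcome : ∀ {m n} (w : Shuffle m n) xs ys → Placed xs ys →
            Outcome (merge w xs ys) (merge (exchange w xs ys) (Vec.map transpose xs) (Vec.map transpose ys))
  outcome done [] [] _ = inj₂ ((λ ()) , refl)
  outcome (left done) (x ∷ []) [] P = outcome-∷ (λ ()) tt (outcome done [] [] (placed-tailˡ P))
  outcome (left (left w)) (x ∷ x₂ ∷ xs) ys P =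
    outcome-∷ (fresh-left (left w) P)
      (no-pair (λ _ x₂≡b → b∉ˡ P (there (here (sym x₂≡b)))) (λ x≡b _ → b∉ˡ P (here (sym x≡b))))
      (outcome (left w) (x₂ ∷ xs) ys (placed-tailˡ P))
  outcome (left (right w)) (x ∷ xs) (y ∷ ys) P with (x ≟ a) ×-dec (y ≟ b)
  ... | yes (refl , refl) = inj₁ (now (inj₁ (refl , refl)) ,
    cong₂ _∷_ (transpose-b (heads-differ P)) (cong₂ _∷_ transpose-a (rest-fixed w P)))
  ... | no ¬ab =
    outcome-∷ (fresh-left (right w) P) (no-pair (curry ¬ab) (λ x≡b _ → b∉ˡ P (here (sym x≡b))))
      (outcome (right w) xs (y ∷ ys) (placed-tailˡ P))
  outcome (right done) [] (y ∷ []) P = outcome-∷ (λ ()) tt (outcome done [] [] (placed-tailʳ P))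
  outcome (right (right w)) xs (y ∷ y₂ ∷ ys) P =
    outcome-∷ (fresh-right (right w) P)
      (no-pair (λ y≡a _ → a∉ʳ P (here (sym y≡a))) (λ _ y₂≡a → a∉ʳ P (there (here (sym y₂≡a)))))
      (outcome (right w) xs (y₂ ∷ ys) (placed-tailʳ P))
  outcome (right (left w)) (x ∷ xs) (y ∷ ys) P with (x ≟ a) ×-dec (y ≟ b)
  ... | yes (refl , refl) = inj₁ (now (inj₂ (refl , refl)) ,
    cong₂ _∷_ transpose-a (cong₂ _∷_ (transpose-b (heads-differ P)) (rest-fixed w P)))
  ... | no ¬ab =
    outcome-∷ (fresh-right (left w) P)
      (no-pair (λ y≡a _ → a∉ʳ P (here (sym y≡a))) (λ y≡b x≡a → ¬ab (x≡a , y≡b)))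
      (outcome (left w) (x ∷ xs) ys (placed-tailʳ P))

  Outside : ℕ → Set
  Outside c = ¬ (b < c × c < a)

  module _ (b<a : b < a) where

    a≢b : a ≢ b
    a≢b a≡b = <-irrefl (sym a≡b) b<a

    transpose-All : ∀ {P : ℕ → Set} {τ} → P a → P b → All P τ → All P (List.map transpose τ)
    transpose-All         pa pb []         = []
    transpose-All {P} {x ∷ _} pa pb (px ∷ pτ) = P-transpose (kind x) ∷ transpose-All pa pb pτ
      where
      P-transpose : Kind x → P (transpose x)
      P-transpose (is-a x≡a)  = subst P (sym (trans (cong transpose x≡a) transpose-a)) pb
      P-transpose (is-b x≡b)  = subst P (sym (trans (cong transpose x≡b) (transpose-b a≢b))) pa
      P-transpose (other p q) = subst P (sym (transpose-other p q)) px

    transpose-mono : ∀ {u v} → Outside u → Outside v → ¬ IsPair u v → u < v → transpose u < transpose v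
    transpose-mono {u} {v} out-u out-v ¬uv u<v with kind u | kind v
    ... | is-a refl  | is-a refl  = contradiction u<v (<-irrefl refl)
    ... | is-b refl  | is-b refl  = contradiction u<v (<-irrefl refl)
    ... | is-a u≡a   | is-b v≡b   = contradiction (inj₁ (u≡a , v≡b)) ¬uv
    ... | is-b u≡b   | is-a v≡a   = contradiction (inj₂ (u≡b , v≡a)) ¬uv
    ... | is-a refl  | other p q  rewrite transpose-a | transpose-other p q = <-trans b<a u<v
    ... | is-b refl  | other p q  rewrite transpose-b a≢b | transpose-other p q = a<v
      where
      a<v : a < v
      a<v with <-cmp a v
      ... | tri< a<v _ _ = a<v
      ... | tri≈ _ a≡v _ = contradiction (sym a≡v) p
      ... | tri> _ _ v<a = contradiction (u<v , v<a) out-v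
    ... | other p q  | is-a refl  rewrite transpose-a | transpose-other p q = u<b
      where
      u<b : u < b
      u<b with <-cmp u b
      ... | tri< u<b _ _ = u<b
      ... | tri≈ _ u≡b _ = contradiction u≡b q
      ... | tri> _ _ b<u = contradiction (b<u , u<v) out-u
    ... | other p q  | is-b refl  rewrite transpose-b a≢b | transpose-other p q = <-trans u<v b<a
    ... | other p q  | other p′ q′ rewrite transpose-other p q | transpose-other p′ q′ = u<v

    comparison-kept : ∀ {u v} → Outside u → Outside v → ¬ IsPair u v →
                      does (v <? u) ≡ does (transpose v <? transpose u)
    comparison-kept {u} {v} out-u out-v ¬uv =
      does-⇔ (mk⇔ (transpose-mono out-v out-u ¬vu) reflect) (v <? u) (transpose v <? transpose u)
      where
      ¬vu : ¬ IsPair v u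
      ¬vu = ¬uv ∘ pair-sym
      reflect : transpose v < transpose u → v < u
      reflect tv<tu with <-cmp v u
      ... | tri< v<u _ _ = v<u
      ... | tri≈ _ refl _ = contradiction tv<tu (<-irrefl refl)
      ... | tri> _ _ u<v = contradiction tv<tu (<-asym (transpose-mono out-u out-v ¬uv u<v))

    desAfter-transpose : ∀ k x ρ → All Outside (x ∷ ρ) → ¬ Adjacent (x ∷ ρ) →
                         desAfter k (transpose x) (List.map transpose ρ) ≡ desAfter k x ρ
    desAfter-transpose k x [] _ _ = refl
    desAfter-transpose k x (y ∷ ρ) (out-x ∷ out-yρ) ¬adj
      rewrite sym (comparison-kept out-x (All.head out-yρ) (¬adj ∘ now))
            | desAfter-transpose (suc k) y ρ out-yρ (¬adj ∘ later) = refl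

    Des-transpose : ∀ τ → All Outside τ → ¬ Adjacent τ → Des (List.map transpose τ) ≡ Des τ
    Des-transpose []      _ _ = refl
    Des-transpose (x ∷ ρ) out ¬adj = desAfter-transpose 1 x ρ out ¬adj

adjacent-sym : ∀ {a b τ} → Transposition.Adjacent a b τ → Transposition.Adjacent b a τ
adjacent-sym (Transposition.now p)     = Transposition.now (Sum.swap p)
adjacent-sym (Transposition.later adj) = Transposition.later (adjacent-sym adj)

-- Exchanging back: the exchange for (b , a) on the transposed words undoes
-- the exchange for (a , b).
module Undo (a b : ℕ) (a≢b : a ≢ b) where
  module T  = Transposition a b
  module T′ = Transposition b a
  open T using (transpose)

  transpose-involutive : ∀ x → T′.transpose (transpose x) ≡ x
  transpose-involutive x with T.kind x
  ... | T.is-a x≡a = subst (λ x → T′.transpose (transpose x) ≡ x) (sym x≡a)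
                        (trans (cong T′.transpose T.transpose-a) T′.transpose-a)
  ... | T.is-b x≡b = subst (λ x → T′.transpose (transpose x) ≡ x) (sym x≡b)
                        (trans (cong T′.transpose (T.transpose-b a≢b)) (T′.transpose-b (a≢b ∘ sym)))
  ... | T.other p q = trans (cong T′.transpose (T.transpose-other p q)) (T′.transpose-other q p)

  transpose-injective : ∀ {u v} → transpose u ≡ transpose v → u ≡ v
  transpose-injective {u} {v} e =
    trans (sym (transpose-involutive u)) (trans (cong T′.transpose e) (transpose-involutive v))

  transpose≡a : ∀ {x} → transpose x ≡ a → x ≡ b
  transpose≡a {x} e =
    trans (sym (transpose-involutive x)) (trans (cong T′.transpose e) (T′.transpose-b (a≢b ∘ sym)))

  transpose≡b : ∀ {x} → transpose x ≡ b → x ≡ a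
  transpose≡b {x} e = trans (sym (transpose-involutive x)) (trans (cong T′.transpose e) T′.transpose-a)

  map-involutive : ∀ {m} (xs : Vec ℕ m) → Vec.map T′.transpose (Vec.map transpose xs) ≡ xs
  map-involutive []       = refl
  map-involutive (x ∷ xs) = cong₂ _∷_ (transpose-involutive x) (map-involutive xs)

  map-involutive-list : ∀ τ → List.map T′.transpose (List.map transpose τ) ≡ τ
  map-involutive-list []      = refl
  map-involutive-list (x ∷ τ) = cong₂ _∷_ (transpose-involutive x) (map-involutive-list τ)

  adjacent-transpose : ∀ τ → T′.Adjacent (List.map transpose τ) → T.Adjacent τ
  adjacent-transpose (u ∷ v ∷ τ) (T′.now (inj₁ (tu≡b , tv≡a))) = T.now (inj₁ (transpose≡b tu≡b , transpose≡a tv≡a))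
  adjacent-transpose (u ∷ v ∷ τ) (T′.now (inj₂ (tu≡a , tv≡b))) = T.now (inj₂ (transpose≡a tu≡a , transpose≡b tv≡b))
  adjacent-transpose (u ∷ τ)     (T′.later adj)              = T.later (adjacent-transpose τ adj)

  placed-transpose : ∀ {m n} {xs : Vec ℕ m} {ys : Vec ℕ n} → T.Placed xs ys →
                     T′.Placed (Vec.map transpose xs) (Vec.map transpose ys)
  placed-transpose {xs = xs} {ys} P = record
    { uniqueˡ  = via-map {Unique} transpose xs (Unique-map⁺ transpose-injective (T.Placed.uniqueˡ P))
    ; uniqueʳ  = via-map {Unique} transpose ys (Unique-map⁺ transpose-injective (T.Placed.uniqueʳ P))
    ; disjoint = subst₂ Disjoint (sym (toList-map transpose xs)) (sym (toList-map transpose ys)) disjoint-map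
    ; b∉ˡ      = via-map {a ∉_} transpose xs λ a∈ → let x , x∈ , e = ∈-map⁻ transpose a∈ in
                   T.Placed.b∉ˡ P (subst (_∈ toList xs) (transpose≡a (sym e)) x∈)
    ; a∉ʳ      = via-map {b ∉_} transpose ys λ b∈ → let y , y∈ , e = ∈-map⁻ transpose b∈ in
                   T.Placed.a∉ʳ P (subst (_∈ toList ys) (transpose≡b (sym e)) y∈)
    }
    where
    disjoint-map : Disjoint (List.map transpose (toList xs)) (List.map transpose (toList ys))
    disjoint-map (z∈xs , z∈ys) with ∈-map⁻ transpose z∈xs | ∈-map⁻ transpose z∈ys
    ... | x , x∈ , refl | y , y∈ , e =
      T.Placed.disjoint P (x∈ , subst (_∈ toList ys) (sym (transpose-injective e)) y∈)

  -- Both exchanges are described by Outcome; adjacency being insensitive to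
  -- order and transposition, the second one undoes the first on every shuffle,
  -- hence on every shuffle word.
  exchange-inverse : ∀ {m n} (w : Shuffle m n) xs ys → T.Placed xs ys →
    T′.exchange (T.exchange w xs ys) (Vec.map transpose xs) (Vec.map transpose ys) ≡ w
  exchange-inverse {m} {n} w xs ys P = merge-injective _ w xs ys (T.Placed.disjoint P) same-shuffle
    where
    xs′ : Vec ℕ m
    xs′ = Vec.map transpose xs
    ys′ : Vec ℕ n
    ys′ = Vec.map transpose ys
    w′ w″ : Shuffle m n
    w′ = T.exchange w xs ys
    w″ = T′.exchange w′ xs′ ys′
    τ : List ℕ
    τ = merge w xs ys
    back : merge w″ xs ys ≡ merge w″ (Vec.map T′.transpose xs′) (Vec.map T′.transpose ys′)
    back = sym (cong₂ (merge w″) (map-involutive xs) (map-involutive ys))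
    same-shuffle : merge w″ xs ys ≡ τ
    same-shuffle with T.outcome w xs ys P | T′.outcome w′ xs′ ys′ (placed-transpose P)
    ... | inj₁ (_ , e₁)    | inj₁ (_ , e₂)     = trans back (trans e₂ e₁)
    ... | inj₁ (adj , e₁)  | inj₂ (¬adj′ , _)  =
      contradiction (subst T′.Adjacent (sym e₁) (adjacent-sym adj)) ¬adj′
    ... | inj₂ (¬adj , e₁) | inj₁ (adj′ , _)   =
      contradiction (adjacent-transpose τ (subst T′.Adjacent e₁ adj′)) ¬adj
    ... | inj₂ (_ , e₁)    | inj₂ (_ , e₂)     =
      trans back (trans e₂ (trans (cong (List.map T′.transpose) e₁) (map-involutive-list τ)))

sum-map-< : ∀ (f : ℕ → ℕ) τ → All (λ x → f x ≤ x) τ → Any (λ x → f x < x) τ → sum (List.map f τ) < sum τ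
sum-map-< f (x ∷ τ) (fx≤x ∷ fτ≤τ) (here fx<x)  = +-mono-<-≤ fx<x (sum-map-≤ τ fτ≤τ)
  where sum-map-≤ : ∀ τ → All (λ x → f x ≤ x) τ → sum (List.map f τ) ≤ sum τ
        sum-map-≤ []      []              = z≤n
        sum-map-≤ (x ∷ τ) (fx≤x ∷ fτ≤τ) = +-mono-≤ fx≤x (sum-map-≤ τ fτ≤τ)
sum-map-< f (x ∷ τ) (fx≤x ∷ fτ≤τ) (there lower) = +-mono-≤-< fx≤x (sum-map-< f τ fτ≤τ lower)

ClosestInversion : List ℕ → List ℕ → Set
ClosestInversion π σ = ∃₂ λ a b → a ∈ π × b ∈ σ × b < a ×
                                  All (Transposition.Outside a b) π × All (Transposition.Outside a b) σ

-- If some letter of π exceeds some letter of σ, there is a closest inversion: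
-- shrink the gap b < a as long as some letter lies strictly inside it.
closest-inversion : ∀ π σ {x y} → x ∈ π → y ∈ σ → y < x → ClosestInversion π σ
closest-inversion π σ x∈π y∈σ y<x = search x∈π y∈σ y<x (<-wellFounded _)
  where
  between? : ∀ x y c → Dec (y < c × c < x)
  between? x y c = (y <? c) ×-dec (c <? x)
  search : ∀ {x y} → x ∈ π → y ∈ σ → y < x → Acc _<_ (x ∸ y) → ClosestInversion π σ
  search {x} {y} x∈π y∈σ y<x (acc smaller) with any? (between? x y) π | any? (between? x y) σ
  ... | yes c∈π | _ = let c , c∈ , (y<c , c<x) = find c∈π in
    search c∈ y∈σ y<c (smaller (∸-monoˡ-< c<x (<⇒≤ y<c)))
  ... | no _ | yes c∈σ = let c , c∈ , (y<c , c<x) = find c∈σ in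
    search x∈π c∈ c<x (smaller (∸-monoʳ-< y<c (<⇒≤ c<x)))
  ... | no none-π | no none-σ = x , y , x∈π , y∈σ , y<x , ¬Any⇒All¬ π none-π , ¬Any⇒All¬ σ none-σ

module Step {m n} (xs : Vec ℕ m) (ys : Vec ℕ n) {a b} (a∈xs : a ∈ toList xs) (b∈ys : b ∈ toList ys)
            (b<a : b < a) (perm-xs : IsPerm (toList xs)) (perm-ys : IsPerm (toList ys))
            (xs#ys : Disjoint (toList xs) (toList ys))
            (out-xs : All (Transposition.Outside a b) (toList xs))
            (out-ys : All (Transposition.Outside a b) (toList ys)) where

  open Transposition a b
  open Undo a b (a≢b b<a) using (map-involutive; placed-transpose; exchange-inverse)
  module T′ = Transposition b a

  xs′ : Vec ℕ m
  xs′ = Vec.map transpose xs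

  ys′ : Vec ℕ n
  ys′ = Vec.map transpose ys

  placed : Placed xs ys
  placed = record
    { uniqueˡ = proj₁ perm-xs ; uniqueʳ = proj₁ perm-ys ; disjoint = xs#ys
    ; b∉ˡ = λ b∈xs → xs#ys (b∈xs , b∈ys) ; a∉ʳ = λ a∈ys → xs#ys (a∈xs , a∈ys) }

  equiv : ShuffleEquiv Des xs ys xs′ ys′
  equiv = equivalence (mk↔ₛ′ forth back forth∘back back∘forth) preserves
    where
    forth : Shuffle m n → Shuffle m n
    forth w = exchange w xs ys
    back : Shuffle m n → Shuffle m n
    back v = T′.exchange v xs′ ys′
    back∘forth : ∀ w → back (forth w) ≡ w
    back∘forth w = exchange-inverse w xs ys placed
    forth∘back : ∀ v → forth (back v) ≡ v
    forth∘back v = subst₂ (λ us vs → exchange (back v) us vs ≡ v) (map-involutive xs) (map-involutive ys)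
      (Undo.exchange-inverse b a (a≢b b<a ∘ sym) v xs′ ys′ (placed-transpose placed))
    preserves : ∀ w → Des (merge (forth w) xs′ ys′) ≡ Des (merge w xs ys)
    preserves w with outcome w xs ys placed
    ... | inj₁ (_ , e)    = cong Des e
    ... | inj₂ (¬adj , e) = trans (cong Des e) (Des-transpose b<a _ (merge-All w xs ys out-xs out-ys) ¬adj)

  positive : ∀ {k} (zs : Vec ℕ k) → All (0 <_) (toList zs) → All (0 <_) (toList (Vec.map transpose zs))
  positive zs = via-map {All (0 <_)} transpose zs ∘
    transpose-All b<a (All.lookup (proj₂ perm-xs) a∈xs) (All.lookup (proj₂ perm-ys) b∈ys)

  perm-xs′ : IsPerm (toList xs′)
  perm-xs′ = T′.Placed.uniqueˡ (placed-transpose placed) , positive xs (proj₂ perm-xs)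

  perm-ys′ : IsPerm (toList ys′)
  perm-ys′ = T′.Placed.uniqueʳ (placed-transpose placed) , positive ys (proj₂ perm-ys)

  disjoint′ : Disjoint (toList xs′) (toList ys′)
  disjoint′ = T′.Placed.disjoint (placed-transpose placed)

  des-xs′ : Des (toList xs′) ≡ Des (toList xs)
  des-xs′ = via-map {λ τ → Des τ ≡ Des (toList xs)} transpose xs
    (Des-transpose b<a _ out-xs (λ adj → Placed.b∉ˡ placed (proj₂ (adjacent-∈ adj))))

  des-ys′ : Des (toList ys′) ≡ Des (toList ys)
  des-ys′ = via-map {λ τ → Des τ ≡ Des (toList ys)} transpose ys
    (Des-transpose b<a _ out-ys (λ adj → Placed.a∉ʳ placed (proj₁ (adjacent-∈ adj))))

  -- The sum of the left word drops: a becomes b < a, nothing else grows.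
  sum-drops : sum (toList xs′) < sum (toList xs)
  sum-drops = via-map {λ τ → sum τ < sum (toList xs)} transpose xs
    (sum-map-< transpose _ (All.tabulate lowers)
      (Any.map (λ a≡x → subst (λ x → transpose x < x) a≡x a-drops) a∈xs))
    where
    a-drops : transpose a < a
    a-drops = subst (_< a) (sym transpose-a) b<a
    lowers : ∀ {x} → x ∈ toList xs → transpose x ≤ x
    lowers {x} x∈xs with kind x
    ... | is-a x≡a  = subst (λ x → transpose x ≤ x) (sym x≡a) (<⇒≤ a-drops)
    ... | is-b x≡b  = contradiction (subst (_∈ toList xs) x≡b x∈xs) (Placed.b∉ˡ placed)
    ... | other p q = subst (_≤ x) (sym (transpose-other p q)) ≤-refl

Below : List ℕ → List ℕ → Set
Below π σ = All (λ x → All (x <_) σ) π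

below? : ∀ π σ → Dec (Below π σ)
below? π σ = all? (λ x → all? (x <?_) σ) π

record Separation {m n} (xs : Vec ℕ m) (ys : Vec ℕ n) : Set where
  field
    lower : Vec ℕ m
    upper : Vec ℕ n
    below : Below (toList lower) (toList upper)
    desˡ  : Des (toList lower) ≡ Des (toList xs)
    desʳ  : Des (toList upper) ≡ Des (toList ys)
    equiv : ShuffleEquiv Des xs ys lower upper

inversion : ∀ {π σ} → ¬ Below π σ → Disjoint π σ → ∃₂ λ x y → x ∈ π × y ∈ σ × y < x
inversion {π} {σ} ¬below π#σ =
  let x , x∈π , ¬x<σ = find (¬All⇒Any¬ (λ x → all? (x <?_) σ) π ¬below)
      y , y∈σ , ¬x<y = find (¬All⇒Any¬ (x <?_) σ ¬x<σ)
  in x , y , x∈π , y∈σ , ≤∧≢⇒< (≮⇒≥ ¬x<y) (λ y≡x → π#σ (x∈π , subst (_∈ σ) y≡x y∈σ))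

-- Every pair of disjoint permutations has a separation: transposition steps
-- lower the sum of the left word until it lies below the right word.
separate : ∀ {m n} (xs : Vec ℕ m) (ys : Vec ℕ n) → IsPerm (toList xs) → IsPerm (toList ys) →
           Disjoint (toList xs) (toList ys) → Separation xs ys
separate xs ys perm-xs perm-ys xs#ys = go xs ys perm-xs perm-ys xs#ys (<-wellFounded _)
  where
  go : ∀ {m n} (xs : Vec ℕ m) (ys : Vec ℕ n) → IsPerm (toList xs) → IsPerm (toList ys) →
       Disjoint (toList xs) (toList ys) → Acc _<_ (sum (toList xs)) → Separation xs ys
  go xs ys perm-xs perm-ys xs#ys (acc smaller) with below? (toList xs) (toList ys)
  ... | yes below = record { lower = xs ; upper = ys ; below = below ; desˡ = refl ; desʳ = refl
                           ; equiv = equiv-refl xs ys }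
  ... | no ¬below with inversion ¬below xs#ys
  ... | x , y , x∈xs , y∈ys , y<x with closest-inversion _ _ x∈xs y∈ys y<x
  ... | a , b , a∈xs , b∈ys , b<a , out-xs , out-ys = record
    { lower = lower ; upper = upper ; below = below
    ; desˡ = trans desˡ des-xs′ ; desʳ = trans desʳ des-ys′
    ; equiv = equiv-trans equiv (Separation.equiv rest) }
    where
    open Step xs ys a∈xs b∈ys b<a perm-xs perm-ys xs#ys out-xs out-ys
    rest : Separation xs′ ys′
    rest = go xs′ ys′ perm-xs′ perm-ys′ disjoint′ (smaller sum-drops)
    open Separation rest using (lower; upper; below; desˡ; desʳ)

mark : ℕ → Bool → List ℕ → List ℕ
mark k b ds = if b then k ∷ ds else ds

desAfter-≥ : ∀ k x ρ → All (k ≤_) (desAfter k x ρ)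
desAfter-≥ k x [] = []
desAfter-≥ k x (y ∷ ρ) with does (y <? x)
... | true  = ≤-refl ∷ All.map (≤-trans (n≤1+n k)) (desAfter-≥ (suc k) y ρ)
... | false = All.map (≤-trans (n≤1+n k)) (desAfter-≥ (suc k) y ρ)

module _ {P : ℕ → Set} (P? : ∀ k → Dec (P k)) where

  filter-mark : ∀ k b ds → filter P? (mark k b ds) ≡ mark k (b ∧ does (P? k)) (filter P? ds)
  filter-mark k false ds = refl
  filter-mark k true  ds with does (P? k)
  ... | true  = refl
  ... | false = refl

mark-injective : ∀ {k b b′ ds ds′} → All (suc k ≤_) ds → All (suc k ≤_) ds′ →
                 mark k b ds ≡ mark k b′ ds′ → b ≡ b′ × ds ≡ ds′
mark-injective {b = false} {false} _ _ e = refl , e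
mark-injective {b = true}  {true}  _ _ e = refl , proj₂ (∷-injective e)
mark-injective {b = true}  {false} _ (k<k ∷ _) refl = ⊥-elim (<-irrefl refl k<k)
mark-injective {b = false} {true}  (k<k ∷ _) _ refl = ⊥-elim (<-irrefl refl k<k)

mask : ∀ {P : Set} (p? : Dec P) b b′ → (P → b ≡ b′) → b ∧ does p? ≡ b′ ∧ does p?
mask (yes p) b b′ same = cong (_∧ true) (same p)
mask (no _)  b b′ _    = trans (∧-zeroʳ b) (sym (∧-zeroʳ b′))

mask⁻ : ∀ {P : Set} (p? : Dec P) b b′ → b ∧ does p? ≡ b′ ∧ does p? → P → b ≡ b′
mask⁻ (yes _) b b′ e _ = trans (sym (∧-identityʳ b)) (trans e (∧-identityʳ b′))
mask⁻ (no ¬p) b b′ _ p = ⊥-elim (¬p p)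

ascent : ∀ {x z} → x < z → does (z <? x) ≡ false
ascent {x} {z} x<z = dec-false (z <? x) (<-asym x<z)

descent : ∀ {x z} → z < x → does (z <? x) ≡ true
descent {x} {z} z<x = dec-true (z <? x) z<x

below-head : ∀ {π y σ} → Below π (y ∷ σ) → All (_< y) π
below-head = All.map All.head

below-tail : ∀ {π y σ} → Below π (y ∷ σ) → Below π σ
below-tail = All.map All.tail

module PartialDescents (i j : ℕ) where

  -- The window of Des_{i,j}: a descent at position k, followed by r further
  -- letters, is recorded iff k ≤ i or r ≤ j.  Shrinking k or r keeps it inside.
  InWindow : ℕ → ℕ → Set
  InWindow k r = k ≤ i ⊎ r ≤ j

  window-mono : ∀ {k k′ r r′} → k′ ≤ k → r′ ≤ r → InWindow k r → InWindow k′ r′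
  window-mono k′≤k _ (inj₁ k≤i) = inj₁ (≤-trans k′≤k k≤i)
  window-mono _ r′≤r (inj₂ r≤j) = inj₂ (≤-trans r′≤r r≤j)

  Kept : ℕ → ℕ → Set
  Kept n k = k ≤ i ⊎ n ∸ j ≤ k

  kept? : ∀ n k → Dec (Kept n k)
  kept? n k = (k ≤? i) ⊎-dec ((n ∸ j) ≤? k)

  window⇒kept : ∀ k r → InWindow k r → Kept (k + r) k
  window⇒kept k r (inj₁ k≤i) = inj₁ k≤i
  window⇒kept k r (inj₂ r≤j) =
    inj₂ (m≤n+o⇒m∸n≤o (k + r) j (subst (k + r ≤_) (+-comm k j) (+-monoʳ-≤ k r≤j)))

  kept⇒window : ∀ k r → Kept (k + r) k → InWindow k r
  kept⇒window k r (inj₁ k≤i) = inj₁ k≤i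
  kept⇒window k r (inj₂ le) = inj₂ (shift j r le)
    where
    shift : ∀ j r → k + r ∸ j ≤ k → r ≤ j
    shift j zero _ = z≤n
    shift zero (suc r) le = contradiction le (m+1+n≰m k)
    shift (suc j) (suc r) le = s≤s (shift j r (subst (λ z → z ∸ suc j ≤ k) (+-suc k r) le))

  -- AgreeAfter k x x′ ρ ρ′: the words x ∷ ρ and x′ ∷ ρ′, whose first letters
  -- sit at position k, have the same length and the same descents at all
  -- positions of the window.
  AgreeAfter : ℕ → ℕ → ℕ → List ℕ → List ℕ → Set
  AgreeAfter k x x′ []      []        = ⊤
  AgreeAfter k x x′ (y ∷ ρ) (y′ ∷ ρ′) =
    (InWindow k (length (y ∷ ρ)) → does (y <? x) ≡ does (y′ <? x′)) × AgreeAfter (suc k) y y′ ρ ρ′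
  AgreeAfter k x x′ _       _         = ⊥

  -- Agree q τ τ′: the same for whole words whose first letters sit at position suc q.
  Agree : ℕ → List ℕ → List ℕ → Set
  Agree q []      []        = ⊤
  Agree q (x ∷ ρ) (x′ ∷ ρ′) = AgreeAfter (suc q) x x′ ρ ρ′
  Agree q _       _         = ⊥

  agreeAfter-length : ∀ {k x x′} ρ ρ′ → AgreeAfter k x x′ ρ ρ′ → length ρ ≡ length ρ′
  agreeAfter-length []      []        _          = refl
  agreeAfter-length (y ∷ ρ) (y′ ∷ ρ′) (_ , rest) = cong suc (agreeAfter-length ρ ρ′ rest)

  agreeAfter⇒agree : ∀ {k x x′} ρ ρ′ → AgreeAfter k x x′ ρ ρ′ → Agree k ρ ρ′
  agreeAfter⇒agree []      []        _          = tt
  agreeAfter⇒agree (y ∷ ρ) (y′ ∷ ρ′) (_ , rest) = rest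

  agreeAfter⇒kept-descents : ∀ n k x x′ ρ ρ′ → k + length ρ ≡ n → AgreeAfter k x x′ ρ ρ′ →
    filter (kept? n) (desAfter k x ρ) ≡ filter (kept? n) (desAfter k x′ ρ′)
  agreeAfter⇒kept-descents n k x x′ [] [] _ _ = refl
  agreeAfter⇒kept-descents n k x x′ (y ∷ ρ) (y′ ∷ ρ′) len (same , rest) = begin
    filter (kept? n) (mark k (does (y <? x)) (desAfter (suc k) y ρ))
      ≡⟨ filter-mark (kept? n) k (does (y <? x)) (desAfter (suc k) y ρ) ⟩
    mark k (does (y <? x) ∧ does (kept? n k)) (filter (kept? n) (desAfter (suc k) y ρ))
      ≡⟨ cong₂ (mark k) (mask (kept? n k) _ _ (same ∘ kept⇒window′))
                        (agreeAfter⇒kept-descents n (suc k) y y′ ρ ρ′ (trans (sym (+-suc k _)) len) rest) ⟩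
    mark k (does (y′ <? x′) ∧ does (kept? n k)) (filter (kept? n) (desAfter (suc k) y′ ρ′))
      ≡⟨ filter-mark (kept? n) k (does (y′ <? x′)) (desAfter (suc k) y′ ρ′) ⟨
    filter (kept? n) (mark k (does (y′ <? x′)) (desAfter (suc k) y′ ρ′)) ∎
    where
    open ≡-Reasoning
    kept⇒window′ : Kept n k → InWindow k (length (y ∷ ρ))
    kept⇒window′ p = kept⇒window k _ (subst (λ n → Kept n k) (sym len) p)

  kept-descents⇒agreeAfter : ∀ n k x x′ ρ ρ′ → k + length ρ ≡ n → length ρ ≡ length ρ′ →
    filter (kept? n) (desAfter k x ρ) ≡ filter (kept? n) (desAfter k x′ ρ′) → AgreeAfter k x x′ ρ ρ′
  kept-descents⇒agreeAfter n k x x′ [] [] _ _ _ = tt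
  kept-descents⇒agreeAfter n k x x′ (y ∷ ρ) (y′ ∷ ρ′) len len′ e =
    (λ w → mask⁻ (kept? n k) _ _ (proj₁ split) (subst (λ n → Kept n k) len (window⇒kept k _ w))) ,
    kept-descents⇒agreeAfter n (suc k) y y′ ρ ρ′ (trans (sym (+-suc k _)) len) (suc-injective len′)
      (proj₂ split)
    where
    later : ∀ y ρ → All (suc k ≤_) (filter (kept? n) (desAfter (suc k) y ρ))
    later y ρ = filter⁺ (kept? n) (desAfter-≥ (suc k) y ρ)
    split : does (y <? x) ∧ does (kept? n k) ≡ does (y′ <? x′) ∧ does (kept? n k)
          × filter (kept? n) (desAfter (suc k) y ρ) ≡ filter (kept? n) (desAfter (suc k) y′ ρ′)
    split = mark-injective (later y ρ) (later y′ ρ′)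
              (trans (sym (filter-mark (kept? n) k (does (y <? x)) (desAfter (suc k) y ρ)))
                (trans e (filter-mark (kept? n) k (does (y′ <? x′)) (desAfter (suc k) y′ ρ′))))

  agree⇒DesPartial : ∀ τ τ′ → Agree 0 τ τ′ → DesPartial i j τ ≡ DesPartial i j τ′
  agree⇒DesPartial []      []        _ = refl
  agree⇒DesPartial (x ∷ ρ) (x′ ∷ ρ′) a =
    trans (agreeAfter⇒kept-descents _ 1 x x′ ρ ρ′ refl a)
          (cong (λ n → filter (kept? (suc n)) (desAfter 1 x′ ρ′)) (agreeAfter-length ρ ρ′ a))

  DesPartial⇒agree : ∀ τ τ′ → length τ ≡ length τ′ → DesPartial i j τ ≡ DesPartial i j τ′ → Agree 0 τ τ′
  DesPartial⇒agree []      []        _   _ = tt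
  DesPartial⇒agree (x ∷ ρ) (x′ ∷ ρ′) len e =
    kept-descents⇒agreeAfter _ 1 x x′ ρ ρ′ refl (suc-injective len)
      (trans e (cong (λ n → filter (kept? n) (desAfter 1 x′ ρ′)) (sym len)))

  mutual
    -- In merge-agree-left the letters z , z′ emitted last
    -- came from the lower words (at position p there); positions only grow
    -- and remaining lengths only shrink when passing from a shuffle to its
    -- factors, so their windows are contained in the shuffle's.
    merge-agree-left : ∀ {m n} (w : Shuffle m n) (xs xs′ : Vec ℕ m) (ys ys′ : Vec ℕ n) {z z′ k p q} →
      p ≤ k → q ≤ k → AgreeAfter p z z′ (toList xs) (toList xs′) → Agree q (toList ys) (toList ys′) →
      All (z <_) (toList ys) → All (z′ <_) (toList ys′) →
      Below (toList xs) (toList ys) → Below (toList xs′) (toList ys′) →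
      AgreeAfter k z z′ (merge w xs ys) (merge w xs′ ys′)
    merge-agree-left done [] [] [] [] _ _ _ _ _ _ _ _ = tt
    merge-agree-left (left w) (x ∷ xs) (x′ ∷ xs′) ys ys′ p≤k q≤k (same , rest) ys≈ _ _
                     (x<ys ∷ xs<ys) (x′<ys′ ∷ xs′<ys′) =
      (λ win → same (window-mono p≤k (s≤s (length-mono-≤ (merge-⊆ˡ w xs ys))) win)) ,
      merge-agree-left w xs xs′ ys ys′ (s≤s p≤k) (≤-trans q≤k (n≤1+n _)) rest ys≈ x<ys x′<ys′ xs<ys xs′<ys′
    merge-agree-left (right w) xs xs′ (y ∷ ys) (y′ ∷ ys′) p≤k q≤k xs≈ ys≈ (z<y ∷ _) (z′<y′ ∷ _)
                     xs<ys xs′<ys′ =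
      (λ _ → trans (ascent z<y) (sym (ascent z′<y′))) ,
      merge-agree-right w xs xs′ ys ys′ (≤-trans p≤k (n≤1+n _)) (s≤s q≤k) ys≈ (agreeAfter⇒agree _ _ xs≈)
        (below-head xs<ys) (below-head xs′<ys′) (below-tail xs<ys) (below-tail xs′<ys′)

    merge-agree-right : ∀ {m n} (w : Shuffle m n) (xs xs′ : Vec ℕ m) (ys ys′ : Vec ℕ n) {z z′ k p q} →
      p ≤ k → q ≤ k → AgreeAfter q z z′ (toList ys) (toList ys′) → Agree p (toList xs) (toList xs′) →
      All (_< z) (toList xs) → All (_< z′) (toList xs′) →
      Below (toList xs) (toList ys) → Below (toList xs′) (toList ys′) →
      AgreeAfter k z z′ (merge w xs ys) (merge w xs′ ys′)
    merge-agree-right done [] [] [] [] _ _ _ _ _ _ _ _ = tt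
    merge-agree-right (left w) (x ∷ xs) (x′ ∷ xs′) ys ys′ p≤k q≤k ys≈ xs≈ (x<z ∷ _) (x′<z′ ∷ _)
                      (x<ys ∷ xs<ys) (x′<ys′ ∷ xs′<ys′) =
      (λ _ → trans (descent x<z) (sym (descent x′<z′))) ,
      merge-agree-left w xs xs′ ys ys′ (s≤s p≤k) (≤-trans q≤k (n≤1+n _)) xs≈ (agreeAfter⇒agree _ _ ys≈)
        x<ys x′<ys′ xs<ys xs′<ys′
    merge-agree-right (right w) xs xs′ (y ∷ ys) (y′ ∷ ys′) p≤k q≤k (same , rest) xs≈ _ _ xs<ys xs′<ys′ =
      (λ win → same (window-mono q≤k (s≤s (length-mono-≤ (merge-⊆ʳ w xs ys))) win)) ,
      merge-agree-right w xs xs′ ys ys′ (≤-trans p≤k (n≤1+n _)) (s≤s q≤k) rest xs≈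
        (below-head xs<ys) (below-head xs′<ys′) (below-tail xs<ys) (below-tail xs′<ys′)

  merge-agree : ∀ {m n} (w : Shuffle m n) (xs xs′ : Vec ℕ m) (ys ys′ : Vec ℕ n) →
    Below (toList xs) (toList ys) → Below (toList xs′) (toList ys′) →
    Agree 0 (toList xs) (toList xs′) → Agree 0 (toList ys) (toList ys′) →
    Agree 0 (merge w xs ys) (merge w xs′ ys′)
  merge-agree done [] [] [] [] _ _ _ _ = tt
  merge-agree (left w) (x ∷ xs) (x′ ∷ xs′) ys ys′ (x<ys ∷ xs<ys) (x′<ys′ ∷ xs′<ys′) xs≈ ys≈ =
    merge-agree-left w xs xs′ ys ys′ ≤-refl z≤n xs≈ ys≈ x<ys x′<ys′ xs<ys xs′<ys′
  merge-agree (right w) xs xs′ (y ∷ ys) (y′ ∷ ys′) xs<ys xs′<ys′ xs≈ ys≈ =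
    merge-agree-right w xs xs′ ys ys′ z≤n ≤-refl ys≈ xs≈
      (below-head xs<ys) (below-head xs′<ys′) (below-tail xs<ys) (below-tail xs′<ys′)

same-length : ∀ {k} (zs zs′ : Vec ℕ k) → length (toList zs) ≡ length (toList zs′)
same-length zs zs′ = trans (length-toList zs) (sym (length-toList zs′))

module _ (i j : ℕ) where
  open PartialDescents i j

  DesPartial-cong : ∀ τ τ′ → length τ ≡ length τ′ → Des τ ≡ Des τ′ → DesPartial i j τ ≡ DesPartial i j τ′
  DesPartial-cong _ _ = cong₂ (λ n ds → filter (kept? n) ds)

  same-Des : ∀ {k} (zs zs′ : Vec ℕ k) → Des (toList zs) ≡ Des (toList zs′) →
             DesPartial i j (toList zs) ≡ DesPartial i j (toList zs′)
  same-Des zs zs′ = DesPartial-cong (toList zs) (toList zs′) (same-length zs zs′)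

  separated-equiv : ∀ {m n m′ n′} (xs : Vec ℕ m) (ys : Vec ℕ n) (xs′ : Vec ℕ m′) (ys′ : Vec ℕ n′) →
    m ≡ m′ → n ≡ n′ → Below (toList xs) (toList ys) → Below (toList xs′) (toList ys′) →
    DesPartial i j (toList xs) ≡ DesPartial i j (toList xs′) →
    DesPartial i j (toList ys) ≡ DesPartial i j (toList ys′) →
    ShuffleEquiv (DesPartial i j) xs ys xs′ ys′
  separated-equiv xs ys xs′ ys′ refl refl below below′ xs≈xs′ ys≈ys′ = equivalence ↔-refl λ w →
    sym (agree⇒DesPartial (merge w xs ys) (merge w xs′ ys′) (merge-agree w xs xs′ ys ys′ below below′
      (DesPartial⇒agree (toList xs) (toList xs′) (same-length xs xs′) xs≈xs′)
      (DesPartial⇒agree (toList ys) (toList ys′) (same-length ys ys′) ys≈ys′)))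

  partialDescent-equiv : ∀ {m n m′ n′} (xs : Vec ℕ m) (ys : Vec ℕ n) (xs′ : Vec ℕ m′) (ys′ : Vec ℕ n′) →
    IsPerm (toList xs) → IsPerm (toList ys) → Disjoint (toList xs) (toList ys) →
    IsPerm (toList xs′) → IsPerm (toList ys′) → Disjoint (toList xs′) (toList ys′) → m ≡ m′ → n ≡ n′ →
    DesPartial i j (toList xs) ≡ DesPartial i j (toList xs′) →
    DesPartial i j (toList ys) ≡ DesPartial i j (toList ys′) →
    ShuffleEquiv (DesPartial i j) xs ys xs′ ys′
  partialDescent-equiv xs ys xs′ ys′ pxs pys xs#ys pxs′ pys′ xs′#ys′ m≡m′ n≡n′ xs≈xs′ ys≈ys′ =
    equiv-trans (coarsen S.equiv)
      (equiv-trans (separated-equiv S.lower S.upper S′.lower S′.upper m≡m′ n≡n′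
                                    S.below S′.below lower≈ upper≈)
                   (equiv-sym (coarsen S′.equiv)))
    where
    module S  = Separation (separate xs ys pxs pys xs#ys)
    module S′ = Separation (separate xs′ ys′ pxs′ pys′ xs′#ys′)
    coarsen : ∀ {k l} {us us′ : Vec ℕ k} {vs vs′ : Vec ℕ l} →
              ShuffleEquiv Des us vs us′ vs′ → ShuffleEquiv (DesPartial i j) us vs us′ vs′
    coarsen = equiv-coarsen (DesPartial i j) DesPartial-cong
    lower≈ : DesPartial i j (toList S.lower) ≡ DesPartial i j (toList S′.lower)
    lower≈ = trans (same-Des S.lower xs S.desˡ) (trans xs≈xs′ (sym (same-Des S′.lower xs′ S′.desˡ)))
    upper≈ : DesPartial i j (toList S.upper) ≡ DesPartial i j (toList S′.upper)
    upper≈ = trans (same-Des S.upper ys S.desʳ) (trans ys≈ys′ (sym (same-Des S′.upper ys′ S′.desʳ)))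

theorem2p9 : (i j : ℕ) → ShuffleCompatible (DesPartial i j)
theorem2p9 i j π σ π′ σ′ pπ pσ π#σ pπ′ pσ′ π′#σ′ π≈π′ σ≈σ′ |π|≡|π′| |σ|≡|σ′| =
  shuffleSet-bijection (DesPartial i j) π σ π′ σ′ pπ pσ π#σ pπ′ pσ′ π′#σ′
    (partialDescent-equiv i j (fromList π) (fromList σ) (fromList π′) (fromList σ′)
      (via-fromList {IsPerm} π pπ) (via-fromList {IsPerm} σ pσ) (via-fromList₂ {Disjoint} π σ π#σ)
      (via-fromList {IsPerm} π′ pπ′) (via-fromList {IsPerm} σ′ pσ′) (via-fromList₂ {Disjoint} π′ σ′ π′#σ′)
      |π|≡|π′| |σ|≡|σ′| (via-fromList₂ {SameDesPartial} π π′ π≈π′) (via-fromList₂ {SameDesPartial} σ σ′ σ≈σ′))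
  where SameDesPartial : List ℕ → List ℕ → Set
        SameDesPartial τ τ′ = DesPartial i j τ ≡ DesPartial i j τ′
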